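{- Let $G=(V,E)$ be a minimally $(r,Q)$-connected graph such that $r_{uv}\in\{0,1,2\}$ for all $u,v\in R$ and $Q\cup R=V$. Let $G'=(V',E')$ be a $2$-connected block of $G$ and let $R'=R\cap V'$. Then $|R'|\ge2$, and there is no proper $2$-connected subgraph of $G'$ that contains $R'$.
   Context: $R,Q\subseteq V$. $\lambda^Q_G(u,v)$ is the maximum number of $uv$-paths pairwise disjoint in edges and in nodes of $Q\setminus\{u,v\}$; $G$ is $(r,Q)$-connected if $\lambda^Q_G(u,v)\ge r_{uv}$ for all $u,v\in R$ with $r_{uv}>0$, and minimally $(r,Q)$-connected if no proper subgraph of $G$ is $(r,Q)$-connected. A block of $G$ is an inclusion-maximal $2$-connected subgraph, or the graph induced by a bridge. -}

module Defs where

open import Data.Nat using (ℕ; _<_; _≤_)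
open import Data.Bool using (Bool; true; false)
open import Data.Fin using (Fin)
open import Data.Fin.Subset using (Subset; _∈_; _∉_; _⊆_)
open import Data.List using (List; []; _∷_)
open import Data.List.Membership.Propositional renaming (_∈_ to _∈ₗ_; _∉_ to _∉ₗ_)
open import Data.List.Relation.Unary.Unique.Propositional using (Unique)
open import Data.Product using (Σ; _×_; _,_)
open import Data.Sum using (_⊎_)
open import Relation.Binary.PropositionalEquality using (_≡_; _≢_)
open import Relation.Nullary using (¬_)
open import Data.Empty using (⊥)

record Graph (n : ℕ) : Set where
  field
    V     : Subset n
    E     : Fin n → Fin n → Bool
    E-sym : ∀ u v → E u v ≡ E v u
    E-irr : ∀ u → E u u ≡ false
    E-V   : ∀ u v → E u v ≡ true → u ∈ V × v ∈ V
open Graph public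

module _ {n : ℕ} where

  _⊑_ : Graph n → Graph n → Set
  H ⊑ G = (V H ⊆ V G) × (∀ u v → E H u v ≡ true → E G u v ≡ true)

  _⊏_ : Graph n → Graph n → Set
  H ⊏ G = (H ⊑ G) ×
          ((Σ (Fin n) λ x → x ∈ V G × x ∉ V H) ⊎
           (Σ (Fin n) λ u → Σ (Fin n) λ v → E G u v ≡ true × E H u v ≡ false))

  data Walk (H : Graph n) : Fin n → Fin n → Set where
    here : ∀ {u} → u ∈ V H → Walk H u u
    step : ∀ {u w v} → E H u w ≡ true → Walk H w v → Walk H u v

  verts : ∀ {H u v} → Walk H u v → List (Fin n)
  verts (here {u} _) = u ∷ []
  verts (step {u} _ w) = u ∷ verts w

  edges : ∀ {H u v} → Walk H u v → List (Fin n × Fin n)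
  edges (here _) = []
  edges (step {u} {w} _ p) = (u , w) ∷ edges p

  Path : Graph n → Fin n → Fin n → Set
  Path H u v = Σ (Walk H u v) λ p → Unique (verts p)

  SameEdge : Fin n × Fin n → Fin n × Fin n → Set
  SameEdge (a , b) (c , d) = (a ≡ c × b ≡ d) ⊎ (a ≡ d × b ≡ c)

  QDisjoint : ∀ {H} (Q : Subset n) (u v : Fin n) → Path H u v → Path H u v → Set
  QDisjoint Q u v (p , _) (q , _) =
    (∀ e e' → e ∈ₗ edges p → e' ∈ₗ edges q → ¬ SameEdge e e') ×
    (∀ x → x ∈ Q → x ≢ u → x ≢ v → x ∈ₗ verts p → x ∈ₗ verts q → ⊥)

  λQ≥ : Graph n → Subset n → Fin n → Fin n → ℕ → Set
  λQ≥ H Q u v k = Σ (Fin k → Path H u v) λ P →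
                    ∀ i j → i ≢ j → QDisjoint Q u v (P i) (P j)

  RQConnected : Graph n → (Fin n → Fin n → ℕ) → Subset n → Subset n → Set
  RQConnected H r R Q = ∀ u v → u ∈ R → v ∈ R → 0 < r u v → λQ≥ H Q u v (r u v)

  MinRQConnected : Graph n → (Fin n → Fin n → ℕ) → Subset n → Subset n → Set
  MinRQConnected G r R Q =
    RQConnected G r R Q × (∀ H → H ⊏ G → ¬ RQConnected H r R Q)

  Connected : Graph n → Set
  Connected H = ∀ u v → u ∈ V H → v ∈ V H → Walk H u v

  ConnectedWithout : Graph n → Fin n → Set
  ConnectedWithout H x = ∀ u v → u ∈ V H → v ∈ V H → u ≢ x → v ≢ x →
                         Σ (Walk H u v) λ p → x ∉ₗ verts p

  TwoConnected : Graph n → Set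
  TwoConnected H = 3 ≤ Data.Fin.Subset.∣ V H ∣ × Connected H ×
                   (∀ x → x ∈ V H → ConnectedWithout H x)

  TwoConnectedBlock : Graph n → Graph n → Set
  TwoConnectedBlock B G = B ⊑ G × TwoConnected B ×
                          (∀ H → H ⊑ G → B ⊏ H → ¬ TwoConnected H)

-- If B had fewer than two terminals, or if a proper 2-connected subgraph H of B contained all of
-- them, some edge st of B could be deleted from G without losing (r,Q)-connectivity, contradicting
-- minimality. Deleting st is harmless as soon as any two distinct terminals α, β of B are joined
-- inside B − st by two edge-disjoint, internally disjoint paths: with fewer than two terminals this
-- is vacuous, and otherwise H, which misses some edge st of B, supplies them by Menger's theorem.
-- Indeed, a single uv-path of G is diverted around st through the 2-connected B. Two Q-disjoint
-- uv-paths that both meet B enter B at the same vertex α and leave it at the same vertex β, since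
-- otherwise an ear would enlarge the block; as common vertices of the two paths, α and β are
-- terminals (Q ∪ R = V), and the two segments inside B are replaced by the two α–β paths in B − st.
-- If only one of the paths meets B, that one is diverted through B − st, which the other avoids.

module Submission where

open import Defs
open import Data.Nat using (ℕ; _≤_; _<_; _+_; _≤?_; z≤n; s≤s)
import Data.Nat.Properties as ℕ
open import Data.Bool using (true; false; _∧_; _∨_; not)
open import Data.Bool.Properties using (∧-conicalˡ; ∧-conicalʳ)
open import Data.Fin using (Fin; zero; suc)
import Data.Fin.Properties as Fin
open import Data.Fin.Subset using (Subset; _∈_; _∩_; _∪_; _-_; _⊆_; ∣_∣; ⁅_⁆; inside; outside; Nonempty)
  renaming (⊥ to ∅)
open import Data.Fin.Subset.Properties
  using (x∈p⇒∣p-x∣<∣p∣; x∈p∧x≢y⇒x∈p-y; x∈⁅y⁆⇒x≡y; x∈⁅x⁆; p⊆q⇒∣p∣≤∣q∣; ∣⁅x⁆∣≡1; x∈p∪q⁺; x∈p∪q⁻; x∈p∩q⁺;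
         nonempty?; Empty-unique; ∣⊥∣≡0; ∉⊥)
  renaming (_∈?_ to _∈ₛ?_)
open import Data.Vec using ([]; _∷_)
open import Data.List using (List; []; _∷_; _++_)
open import Data.List.Membership.Propositional using (find; lose) renaming (_∈_ to _∈ₗ_; _∉_ to _∉ₗ_)
open import Data.List.Membership.Propositional.Properties using (∈-++⁻)
import Data.List.Membership.DecPropositional as DecMembership
open import Data.List.Relation.Binary.Subset.Propositional using () renaming (_⊆_ to _⊆ₗ_)
open import Data.List.Relation.Unary.Any using (Any; any?) renaming (here to hereₗ; there to thereₗ)
import Data.List.Relation.Unary.Any as Any
open import Data.List.Relation.Unary.All using ([]; _∷_; lookup)
open import Data.List.Relation.Unary.All.Properties using (¬Any⇒All¬)
open import Data.List.Relation.Unary.AllPairs using ([]; _∷_)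
open import Data.List.Relation.Unary.Unique.Propositional using (Unique)
open import Data.Product using (Σ; _×_; _,_; proj₁; proj₂)
open import Data.Sum using (_⊎_; inj₁; inj₂; [_,_]; swap)
open import Data.Empty using (⊥; ⊥-elim)
open import Function using (_∘_; id; mk⇔)
open import Relation.Binary.PropositionalEquality using (_≡_; _≢_; refl; sym; trans; cong; cong₂; subst)
open import Relation.Nullary using (¬_; ¬?; yes; no; Dec; does; _×-dec_; _⊎-dec_)
open import Relation.Nullary.Decidable using (does-⇔; dec-true; dec-false)
open import Relation.Unary using (Decidable)

variable
  n : ℕ
  H K : Graph n
  a b c d s t u v x y z : Fin n

-- Walks
_++ʷ_ : Walk H a b → Walk H b c → Walk H a c
here _ ++ʷ q = q
step e p ++ʷ q = step e (p ++ʷ q)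

start∈verts : (p : Walk H a b) → a ∈ₗ verts p
start∈verts (here _) = hereₗ refl
start∈verts (step _ _) = hereₗ refl

end∈verts : (p : Walk H a b) → b ∈ₗ verts p
end∈verts (here _) = hereₗ refl
end∈verts (step _ p) = thereₗ (end∈verts p)

∈verts⇒∈V : (p : Walk H a b) → x ∈ₗ verts p → x ∈ V H
∈verts⇒∈V (here x∈V) (hereₗ refl) = x∈V
∈verts⇒∈V {H = H} (step e p) (hereₗ refl) = proj₁ (E-V H _ _ e)
∈verts⇒∈V (step e p) (thereₗ i) = ∈verts⇒∈V p i

∈edges⇒E : (p : Walk H a b) → (x , y) ∈ₗ edges p → E H x y ≡ true
∈edges⇒E (step e p) (hereₗ refl) = e
∈edges⇒E (step e p) (thereₗ i) = ∈edges⇒E p i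

∈edges⇒∈verts : (p : Walk H a b) → (x , y) ∈ₗ edges p → x ∈ₗ verts p × y ∈ₗ verts p
∈edges⇒∈verts (step e p) (hereₗ refl) = hereₗ refl , thereₗ (start∈verts p)
∈edges⇒∈verts (step e p) (thereₗ i) with ∈edges⇒∈verts p i
... | x∈p , y∈p = thereₗ x∈p , thereₗ y∈p

edges-++ʷ : (p : Walk H a b) (q : Walk H b c) → edges (p ++ʷ q) ≡ edges p ++ edges q
edges-++ʷ (here _) q = refl
edges-++ʷ (step e p) q = cong (_ ∷_) (edges-++ʷ p q)

∈-edges-++ʷ⁻ : ∀ {e} (p : Walk H a b) (q : Walk H b c) → e ∈ₗ edges (p ++ʷ q) → e ∈ₗ edges p ⊎ e ∈ₗ edges q
∈-edges-++ʷ⁻ p q i rewrite edges-++ʷ p q = ∈-++⁻ (edges p) i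

∈-verts-++ʷ⁻ : (p : Walk H a b) (q : Walk H b c) → x ∈ₗ verts (p ++ʷ q) → x ∈ₗ verts p ⊎ x ∈ₗ verts q
∈-verts-++ʷ⁻ (here _) q i = inj₂ i
∈-verts-++ʷ⁻ (step e p) q (hereₗ refl) = inj₁ (hereₗ refl)
∈-verts-++ʷ⁻ (step e p) q (thereₗ i) with ∈-verts-++ʷ⁻ p q i
... | inj₁ j = inj₁ (thereₗ j)
... | inj₂ j = inj₂ j

∈-verts-++ʷ⁺ˡ : (p : Walk H a b) (q : Walk H b c) → x ∈ₗ verts p → x ∈ₗ verts (p ++ʷ q)
∈-verts-++ʷ⁺ˡ (here _) q (hereₗ refl) = start∈verts q
∈-verts-++ʷ⁺ˡ (step e p) q (hereₗ refl) = hereₗ refl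
∈-verts-++ʷ⁺ˡ (step e p) q (thereₗ i) = thereₗ (∈-verts-++ʷ⁺ˡ p q i)

∈-verts-++ʷ⁺ʳ : (p : Walk H a b) (q : Walk H b c) → x ∈ₗ verts q → x ∈ₗ verts (p ++ʷ q)
∈-verts-++ʷ⁺ʳ (here _) q i = i
∈-verts-++ʷ⁺ʳ (step e p) q i = thereₗ (∈-verts-++ʷ⁺ʳ p q i)

reverse : Walk H a b → Walk H b a
reverse (here a∈V) = here a∈V
reverse {H = H} (step e p) = reverse p ++ʷ step (trans (E-sym H _ _) e) (here (proj₁ (E-V H _ _ e)))

∈-verts-reverse⁻ : (p : Walk H a b) → x ∈ₗ verts (reverse p) → x ∈ₗ verts p
∈-verts-reverse⁻ (here _) i = i
∈-verts-reverse⁻ (step e p) i with ∈-verts-++ʷ⁻ (reverse p) _ i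
... | inj₁ j = thereₗ (∈-verts-reverse⁻ p j)
... | inj₂ (hereₗ refl) = thereₗ (start∈verts p)
... | inj₂ (thereₗ (hereₗ refl)) = hereₗ refl

∈-verts-reverse⁺ : (p : Walk H a b) → x ∈ₗ verts p → x ∈ₗ verts (reverse p)
∈-verts-reverse⁺ (here _) i = i
∈-verts-reverse⁺ (step e p) (hereₗ refl) = ∈-verts-++ʷ⁺ʳ (reverse p) _ (thereₗ (hereₗ refl))
∈-verts-reverse⁺ (step e p) (thereₗ i) = ∈-verts-++ʷ⁺ˡ (reverse p) _ (∈-verts-reverse⁺ p i)

∈-edges-reverse⁻ : (p : Walk H a b) → (x , y) ∈ₗ edges (reverse p) → (y , x) ∈ₗ edges p
∈-edges-reverse⁻ (step e p) i with ∈-edges-++ʷ⁻ (reverse p) _ i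
... | inj₁ j = thereₗ (∈-edges-reverse⁻ p j)
... | inj₂ (hereₗ refl) = hereₗ refl

module _ {H K : Graph n} where

  transport : (p : Walk H a b) → (∀ {x} → x ∈ₗ verts p → x ∈ V K) →
              (∀ {x y} → (x , y) ∈ₗ edges p → E K x y ≡ true) → Walk K a b
  transport (here _) ∈V ∈E = here (∈V (hereₗ refl))
  transport (step _ p) ∈V ∈E = step (∈E (hereₗ refl)) (transport p (∈V ∘ thereₗ) (∈E ∘ thereₗ))

  verts-transport : (p : Walk H a b) (∈V : ∀ {x} → x ∈ₗ verts p → x ∈ V K)
                    (∈E : ∀ {x y} → (x , y) ∈ₗ edges p → E K x y ≡ true) →
                    verts (transport p ∈V ∈E) ≡ verts p
  verts-transport (here _) ∈V ∈E = refl
  verts-transport (step _ p) ∈V ∈E = cong (_ ∷_) (verts-transport p (∈V ∘ thereₗ) (∈E ∘ thereₗ))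

  edges-transport : (p : Walk H a b) (∈V : ∀ {x} → x ∈ₗ verts p → x ∈ V K)
                    (∈E : ∀ {x y} → (x , y) ∈ₗ edges p → E K x y ≡ true) →
                    edges (transport p ∈V ∈E) ≡ edges p
  edges-transport (here _) ∈V ∈E = refl
  edges-transport (step _ p) ∈V ∈E = cong (_ ∷_) (edges-transport p (∈V ∘ thereₗ) (∈E ∘ thereₗ))

weaken : H ⊑ K → Walk H a b → Walk K a b
weaken (⊆V , ⊆E) p = transport p (⊆V ∘ ∈verts⇒∈V p) (⊆E _ _ ∘ ∈edges⇒E p)

verts-weaken : (H⊑K : H ⊑ K) (p : Walk H a b) → verts (weaken H⊑K p) ≡ verts p
verts-weaken {K = K} (⊆V , ⊆E) p = verts-transport {K = K} p (⊆V ∘ ∈verts⇒∈V p) (⊆E _ _ ∘ ∈edges⇒E p)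

record PathWithin {H : Graph n} {a b} (p : Walk H a b) : Set where
  constructor pathWithin
  field
    path    : Walk H a b
    unique  : Unique (verts path)
    verts⊆  : verts path ⊆ₗ verts p
    edges⊆  : edges path ⊆ₗ edges p

module _ {H : Graph n} where
  open DecMembership (Fin._≟_ {n}) using (_∈?_)

  private
    suffixFrom : (p : Walk H a b) → z ∈ₗ verts p → Walk H z b
    suffixFrom (here z∈V) (hereₗ refl) = here z∈V
    suffixFrom (step e p) (hereₗ refl) = step e p
    suffixFrom (step e p) (thereₗ i) = suffixFrom p i

    verts-suffixFrom : (p : Walk H a b) (i : z ∈ₗ verts p) → verts (suffixFrom p i) ⊆ₗ verts p
    verts-suffixFrom (here _) (hereₗ refl) j = j
    verts-suffixFrom (step e p) (hereₗ refl) j = j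
    verts-suffixFrom (step e p) (thereₗ i) j = thereₗ (verts-suffixFrom p i j)

    edges-suffixFrom : (p : Walk H a b) (i : z ∈ₗ verts p) → edges (suffixFrom p i) ⊆ₗ edges p
    edges-suffixFrom (here _) (hereₗ refl) j = j
    edges-suffixFrom (step e p) (hereₗ refl) j = j
    edges-suffixFrom (step e p) (thereₗ i) j = thereₗ (edges-suffixFrom p i j)

    unique-suffixFrom : (p : Walk H a b) (i : z ∈ₗ verts p) → Unique (verts p) → Unique (verts (suffixFrom p i))
    unique-suffixFrom (here _) (hereₗ refl) p! = p!
    unique-suffixFrom (step e p) (hereₗ refl) p! = p!
    unique-suffixFrom (step e p) (thereₗ i) (_ ∷ p!) = unique-suffixFrom p i p!

  loopErase : (p : Walk H a b) → PathWithin p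
  loopErase (here a∈V) = pathWithin (here a∈V) ([] ∷ []) id id
  loopErase {a = a} (step e p) with loopErase p
  ... | pathWithin q q! q⊆p q⊆ₑp with a ∈? verts q
  ... | yes a∈q = pathWithin (suffixFrom q a∈q) (unique-suffixFrom q a∈q q!)
                              (thereₗ ∘ q⊆p ∘ verts-suffixFrom q a∈q) (thereₗ ∘ q⊆ₑp ∘ edges-suffixFrom q a∈q)
  ... | no a∉q = pathWithin (step e q) (¬Any⇒All¬ (verts q) a∉q ∷ q!) ⊆v ⊆e
    where
      ⊆v : verts (step e q) ⊆ₗ verts (step e p)
      ⊆v (hereₗ refl) = hereₗ refl
      ⊆v (thereₗ j) = thereₗ (q⊆p j)
      ⊆e : edges (step e q) ⊆ₗ edges (step e p)
      ⊆e (hereₗ refl) = hereₗ refl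
      ⊆e (thereₗ j) = thereₗ (q⊆ₑp j)

record SplitAt {H : Graph n} {a b} (p : Walk H a b) (z : Fin n) : Set where
  constructor splitAt
  field
    prefix        : Walk H a z
    suffix        : Walk H z b
    verts-prefix⊆ : verts prefix ⊆ₗ verts p
    edges-prefix⊆ : edges prefix ⊆ₗ edges p
    verts-suffix⊆ : verts suffix ⊆ₗ verts p
    edges-suffix⊆ : edges suffix ⊆ₗ edges p
    meet-only-at  : x ∈ₗ verts prefix → x ∈ₗ verts suffix → x ≡ z

split : (p : Walk H a b) → Unique (verts p) → z ∈ₗ verts p → SplitAt p z
split (here z∈V) _ (hereₗ refl) = splitAt (here z∈V) (here z∈V) id id id id λ { (hereₗ refl) _ → refl }
split {z = z} (step {u = a} e p) (a∉p ∷ p!) _ with a Fin.≟ z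
... | yes refl = splitAt (here (∈verts⇒∈V (step e p) (hereₗ refl))) (step e p)
                   (λ { (hereₗ refl) → hereₗ refl }) (λ ()) id id λ { (hereₗ refl) _ → refl }
split (step e p) (a∉p ∷ p!) (hereₗ refl) | no a≢z = ⊥-elim (a≢z refl)
split (step e p) (a∉p ∷ p!) (thereₗ z∈p) | no a≢z with split p p! z∈p
... | splitAt pre suf ⊆v ⊆e ⊆v′ ⊆e′ meet =
  splitAt (step e pre) suf
    (λ { (hereₗ refl) → hereₗ refl ; (thereₗ j) → thereₗ (⊆v j) })
    (λ { (hereₗ refl) → hereₗ refl ; (thereₗ j) → thereₗ (⊆e j) })
    (thereₗ ∘ ⊆v′) (thereₗ ∘ ⊆e′) meet′
  where
    meet′ : x ∈ₗ verts (step e pre) → x ∈ₗ verts suf → x ≡ _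
    meet′ (hereₗ refl) k = ⊥-elim (lookup a∉p (⊆v′ k) refl)
    meet′ (thereₗ j) k = meet j k

module _ {S : Fin n → Set} (S? : Decidable S) where

  record FirstHit {H : Graph n} {a b} (p : Walk H a b) : Set where
    constructor firstHit
    field
      hit           : Fin n
      hit∈S         : S hit
      prefix        : Walk H a hit
      only-hit      : x ∈ₗ verts prefix → S x → x ≡ hit
      verts-prefix⊆ : verts prefix ⊆ₗ verts p
      edges-prefix⊆ : edges prefix ⊆ₗ edges p

  first : (p : Walk H a b) → Any S (verts p) → FirstHit p
  first (here a∈V) (hereₗ s) = firstHit _ s (here a∈V) (λ { (hereₗ refl) _ → refl }) id id
  first {a = a} (step e p) any with S? a
  ... | yes s = firstHit a s (here (∈verts⇒∈V (step e p) (hereₗ refl))) (λ { (hereₗ refl) _ → refl })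
                  (λ { (hereₗ refl) → hereₗ refl }) (λ ())
  first (step e p) (hereₗ s) | no ¬s = ⊥-elim (¬s s)
  first (step e p) (thereₗ any) | no ¬s with first p any
  ... | firstHit h s pre misses ⊆v ⊆e =
    firstHit h s (step e pre)
      (λ { (hereₗ refl) s′ → ⊥-elim (¬s s′) ; (thereₗ j) → misses j })
      (λ { (hereₗ refl) → hereₗ refl ; (thereₗ j) → thereₗ (⊆v j) })
      (λ { (hereₗ refl) → hereₗ refl ; (thereₗ j) → thereₗ (⊆e j) })

∣p∪q∣≤∣p∣+∣q∣ : (p q : Subset n) → ∣ p ∪ q ∣ ≤ ∣ p ∣ + ∣ q ∣
∣p∪q∣≤∣p∣+∣q∣ [] [] = z≤n
∣p∪q∣≤∣p∣+∣q∣ (inside ∷ p) (inside ∷ q) =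
  s≤s (ℕ.≤-trans (ℕ.m≤n⇒m≤1+n (∣p∪q∣≤∣p∣+∣q∣ p q)) (ℕ.≤-reflexive (sym (ℕ.+-suc ∣ p ∣ ∣ q ∣))))
∣p∪q∣≤∣p∣+∣q∣ (inside ∷ p) (outside ∷ q) = s≤s (∣p∪q∣≤∣p∣+∣q∣ p q)
∣p∪q∣≤∣p∣+∣q∣ (outside ∷ p) (inside ∷ q) =
  ℕ.≤-trans (s≤s (∣p∪q∣≤∣p∣+∣q∣ p q)) (ℕ.≤-reflexive (sym (ℕ.+-suc ∣ p ∣ ∣ q ∣)))
∣p∪q∣≤∣p∣+∣q∣ (outside ∷ p) (outside ∷ q) = ∣p∪q∣≤∣p∣+∣q∣ p q

a≢b∧a,b∈p⇒2≤∣p∣ : ∀ {p : Subset n} → a ≢ b → a ∈ p → b ∈ p → 2 ≤ ∣ p ∣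
a≢b∧a,b∈p⇒2≤∣p∣ {a = a} {b = b} {p = p} a≢b a∈p b∈p = ℕ.≤-trans (s≤s 1≤∣p-a∣) (x∈p⇒∣p-x∣<∣p∣ a∈p)
  where
    ⁅b⁆⊆p-a : ⁅ b ⁆ ⊆ p - a
    ⁅b⁆⊆p-a x∈⁅b⁆ rewrite x∈⁅y⁆⇒x≡y b x∈⁅b⁆ = x∈p∧x≢y⇒x∈p-y b∈p (a≢b ∘ sym)
    1≤∣p-a∣ : 1 ≤ ∣ p - a ∣
    1≤∣p-a∣ = subst (_≤ ∣ p - a ∣) (∣⁅x⁆∣≡1 b) (p⊆q⇒∣p∣≤∣q∣ ⁅b⁆⊆p-a)

0<∣p∣⇒Nonempty : ∀ {p : Subset n} → 0 < ∣ p ∣ → Nonempty p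
0<∣p∣⇒Nonempty {n = n} {p = p} 0<∣p∣ with nonempty? p
... | yes ne = ne
... | no ¬ne = ⊥-elim (ℕ.<-irrefl (sym ∣p∣≡0) 0<∣p∣)
  where ∣p∣≡0 = trans (cong ∣_∣ (Empty-unique ¬ne)) (∣⊥∣≡0 n)

2<∣p∣⇒∃-third : ∀ {p : Subset n} → 2 < ∣ p ∣ → (a b : Fin n) → Σ (Fin n) λ c → c ∈ p × c ≢ a × c ≢ b
2<∣p∣⇒∃-third {p = p} 2<∣p∣ a b with Fin.any? (λ c → (c ∈ₛ? p) ×-dec ¬? (c Fin.≟ a) ×-dec ¬? (c Fin.≟ b))
... | yes found = found
... | no none = ⊥-elim (ℕ.<⇒≱ 2<∣p∣ ∣p∣≤2)
  where
    p⊆⁅a⁆∪⁅b⁆ : p ⊆ ⁅ a ⁆ ∪ ⁅ b ⁆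
    p⊆⁅a⁆∪⁅b⁆ {c} c∈p with c Fin.≟ a | c Fin.≟ b
    ... | yes refl | _        = x∈p∪q⁺ (inj₁ (x∈⁅x⁆ c))
    ... | no _     | yes refl = x∈p∪q⁺ (inj₂ (x∈⁅x⁆ c))
    ... | no c≢a   | no c≢b   = ⊥-elim (none (c , c∈p , c≢a , c≢b))
    ∣p∣≤2 : ∣ p ∣ ≤ 2
    ∣p∣≤2 = ℕ.≤-trans (p⊆q⇒∣p∣≤∣q∣ p⊆⁅a⁆∪⁅b⁆)
              (ℕ.≤-trans (∣p∪q∣≤∣p∣+∣q∣ ⁅ a ⁆ ⁅ b ⁆) (ℕ.≤-reflexive (cong₂ _+_ (∣⁅x⁆∣≡1 a) (∣⁅x⁆∣≡1 b))))

sameEdge? : (e f : Fin n × Fin n) → Dec (SameEdge e f)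
sameEdge? (x , y) (s , t) = ((x Fin.≟ s) ×-dec (y Fin.≟ t)) ⊎-dec ((x Fin.≟ t) ×-dec (y Fin.≟ s))

SameEdge-flipˡ : SameEdge (x , y) (s , t) → SameEdge (y , x) (s , t)
SameEdge-flipˡ (inj₁ (p , q)) = inj₂ (q , p)
SameEdge-flipˡ (inj₂ (p , q)) = inj₁ (q , p)

SameEdge-flipʳ : SameEdge (x , y) (s , t) → SameEdge (x , y) (t , s)
SameEdge-flipʳ (inj₁ (p , q)) = inj₂ (p , q)
SameEdge-flipʳ (inj₂ (p , q)) = inj₁ (p , q)

SameEdge-sym : ∀ {e f : Fin n × Fin n} → SameEdge e f → SameEdge f e
SameEdge-sym (inj₁ (p , q)) = inj₁ (sym p , sym q)
SameEdge-sym (inj₂ (p , q)) = inj₂ (sym q , sym p)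

SameEdge-E : ∀ (H : Graph n) → SameEdge (x , y) (s , t) → E H s t ≡ true → E H x y ≡ true
SameEdge-E H (inj₁ (refl , refl)) e = e
SameEdge-E H (inj₂ (refl , refl)) e = trans (E-sym H _ _) e

SameEdge-∈verts : ∀ {e} (w : Walk H a b) → e ∈ₗ edges w → SameEdge (x , y) e → x ∈ₗ verts w × y ∈ₗ verts w
SameEdge-∈verts w i (inj₁ (refl , refl)) = ∈edges⇒∈verts w i
SameEdge-∈verts w i (inj₂ (refl , refl)) = let x∈w , y∈w = ∈edges⇒∈verts w i in y∈w , x∈w

E⇒≢ : ∀ (H : Graph n) → E H x y ≡ true → x ≢ y
E⇒≢ {x = x} H e refl with trans (sym e) (E-irr H x)
... | ()

b≡true⇒b≢false : ∀ {b} → b ≡ true → b ≢ false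
b≡true⇒b≢false refl ()

private
  ∨-true⁻ : ∀ {a b} → a ∨ b ≡ true → a ≡ true ⊎ b ≡ true
  ∨-true⁻ {true} _ = inj₁ refl
  ∨-true⁻ {false} e = inj₂ e

  ∨-trueʳ : ∀ {a b} → b ≡ true → a ∨ b ≡ true
  ∨-trueʳ {true} _ = refl
  ∨-trueʳ {false} e = e

deleteEdge : Graph n → Fin n → Fin n → Graph n
deleteEdge K s t = record
  { V = V K
  ; E = λ x y → E K x y ∧ not (does (sameEdge? (x , y) (s , t)))
  ; E-sym = λ x y → cong₂ _∧_ (E-sym K x y) (cong not (does-⇔ (mk⇔ SameEdge-flipˡ SameEdge-flipˡ)
                                                              (sameEdge? (x , y) (s , t)) (sameEdge? (y , x) (s , t))))
  ; E-irr = λ x → cong (_∧ _) (E-irr K x)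
  ; E-V = λ x y → E-V K x y ∘ ∧-conicalˡ _ _
  }

module _ {K : Graph n} where

  deleteEdge-E⁻ : E (deleteEdge K s t) x y ≡ true → E K x y ≡ true
  deleteEdge-E⁻ = ∧-conicalˡ _ _

  deleteEdge-E⁺ : E K x y ≡ true → ¬ SameEdge (x , y) (s , t) → E (deleteEdge K s t) x y ≡ true
  deleteEdge-E⁺ {x = x} {y} {s} {t} e ¬same = cong₂ _∧_ e (cong not (dec-false (sameEdge? (x , y) (s , t)) ¬same))

  deleteEdge-¬E : E (deleteEdge K s t) x y ≡ true → ¬ SameEdge (x , y) (s , t)
  deleteEdge-¬E {s = s} {t} {x} {y} e same
    with subst (λ b → not b ≡ true) (dec-true (sameEdge? (x , y) (s , t)) same) (∧-conicalʳ _ _ e)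
  ... | ()

  deleteEdge-⊑ : deleteEdge K s t ⊑ K
  deleteEdge-⊑ = id , λ _ _ → deleteEdge-E⁻

  deleteEdge-⊏ : E K s t ≡ true → deleteEdge K s t ⊏ K
  deleteEdge-⊏ {s = s} {t} e =
    deleteEdge-⊑ , inj₂ (s , t , e , cong₂ _∧_ e (cong not (dec-true (sameEdge? (s , t) (s , t)) (inj₁ (refl , refl)))))

  bypass : Walk (deleteEdge K s t) s t → Walk K a b → Walk (deleteEdge K s t) a b
  bypass detour (here a∈K) = here a∈K
  bypass {s = s} {t} detour (step {u = u} {w = v} e p) with sameEdge? (u , v) (s , t)
  ... | no ¬same = step (deleteEdge-E⁺ e ¬same) (bypass detour p)
  ... | yes (inj₁ (refl , refl)) = detour ++ʷ bypass detour p
  ... | yes (inj₂ (refl , refl)) = reverse detour ++ʷ bypass detour p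

fromList : List (Fin n) → Subset n
fromList [] = ∅
fromList (x ∷ xs) = ⁅ x ⁆ ∪ fromList xs

∈-fromList⁺ : ∀ {xs} → x ∈ₗ xs → x ∈ fromList xs
∈-fromList⁺ (hereₗ refl) = x∈p∪q⁺ (inj₁ (x∈⁅x⁆ _))
∈-fromList⁺ (thereₗ i) = x∈p∪q⁺ (inj₂ (∈-fromList⁺ i))

∈-fromList⁻ : ∀ xs → x ∈ fromList xs → x ∈ₗ xs
∈-fromList⁻ [] i = ⊥-elim (∉⊥ i)
∈-fromList⁻ (y ∷ xs) i with x∈p∪q⁻ ⁅ y ⁆ (fromList xs) i
... | inj₁ j = hereₗ (x∈⁅y⁆⇒x≡y y j)
... | inj₂ j = thereₗ (∈-fromList⁻ xs j)

module _ (K : Graph n) {G : Graph n} {a b : Fin n} (p : Walk G a b) where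

  private
    OnP : Fin n → Fin n → Set
    OnP x y = Any (SameEdge (x , y)) (edges p)

    onP? : ∀ x y → Dec (OnP x y)
    onP? x y = any? (sameEdge? (x , y)) (edges p)

    onP⇒∈verts : OnP x y → x ∈ₗ verts p × y ∈ₗ verts p
    onP⇒∈verts onP = let _ , i , same = find onP in SameEdge-∈verts p i same

    onP⇒E : OnP x y → E G x y ≡ true
    onP⇒E onP = let _ , i , same = find onP in SameEdge-E G same (∈edges⇒E p i)

    ¬onP-loop : ∀ x → does (onP? x x) ≡ false
    ¬onP-loop x = dec-false (onP? x x) λ onP → E⇒≢ G (onP⇒E onP) refl

  addWalk : Graph n
  addWalk = record
    { V = V K ∪ fromList (verts p)
    ; E = λ x y → E K x y ∨ does (onP? x y)
    ; E-sym = λ x y → cong₂ _∨_ (E-sym K x y)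
                        (does-⇔ (mk⇔ (Any.map SameEdge-flipˡ) (Any.map SameEdge-flipˡ)) (onP? x y) (onP? y x))
    ; E-irr = λ x → cong₂ _∨_ (E-irr K x) (¬onP-loop x)
    ; E-V = λ x y → E-V′ ∘ ∨-true⁻
    }
    where
      V′ = V K ∪ fromList (verts p)
      E-V′ : E K x y ≡ true ⊎ does (onP? x y) ≡ true → x ∈ V′ × y ∈ V′
      E-V′ {x} {y} (inj₁ e) = x∈p∪q⁺ (inj₁ (proj₁ (E-V K x y e))) , x∈p∪q⁺ (inj₁ (proj₂ (E-V K x y e)))
      E-V′ {x} {y} (inj₂ e) with onP? x y
      ... | yes onP = x∈p∪q⁺ (inj₂ (∈-fromList⁺ (proj₁ (onP⇒∈verts onP))))
                    , x∈p∪q⁺ (inj₂ (∈-fromList⁺ (proj₂ (onP⇒∈verts onP))))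

  ⊑-addWalk : K ⊑ addWalk
  ⊑-addWalk = (λ i → x∈p∪q⁺ (inj₁ i)) , λ _ _ e → cong (_∨ _) e

  ∈verts⇒∈V-addWalk : x ∈ₗ verts p → x ∈ V addWalk
  ∈verts⇒∈V-addWalk i = x∈p∪q⁺ (inj₂ (∈-fromList⁺ i))

  ∈edges⇒E-addWalk : (x , y) ∈ₗ edges p ⊎ (y , x) ∈ₗ edges p → E addWalk x y ≡ true
  ∈edges⇒E-addWalk {x} {y} (inj₁ i) = ∨-trueʳ {E K x y} (dec-true (onP? x y) (lose i (inj₁ (refl , refl))))
  ∈edges⇒E-addWalk {x} {y} (inj₂ i) = ∨-trueʳ {E K x y} (dec-true (onP? x y) (lose i (inj₂ (refl , refl))))

  addWalk-⊑ : K ⊑ G → addWalk ⊑ G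
  addWalk-⊑ (⊆V , ⊆E) = ⊆V′ , ⊆E′
    where
      ⊆V′ : ∀ {x} → x ∈ V addWalk → x ∈ V G
      ⊆V′ {x} i with x∈p∪q⁻ (V K) _ i
      ... | inj₁ j = ⊆V j
      ... | inj₂ j = ∈verts⇒∈V p (∈-fromList⁻ _ j)
      ⊆E′ : ∀ x y → E addWalk x y ≡ true → E G x y ≡ true
      ⊆E′ x y e with ∨-true⁻ {E K x y} e
      ... | inj₁ e′ = ⊆E x y e′
      ... | inj₂ e′ with onP? x y
      ... | yes onP = onP⇒E onP

-- 2-connected graphs
module _ {K : Graph n} (K-2conn : TwoConnected K) where

  private
    connected = proj₁ (proj₂ K-2conn)
    connected-without = proj₂ (proj₂ K-2conn)

  walk-avoiding : c ∈ V K → d ∈ V K → c ≢ x → d ≢ x → Σ (Walk K c d) λ w → x ∉ₗ verts w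
  walk-avoiding {c = c} {d} {x} c∈K d∈K c≢x d≢x with x ∈ₛ? V K
  ... | yes x∈K = connected-without x x∈K c d c∈K d∈K c≢x d≢x
  ... | no x∉K = connected c d c∈K d∈K , x∉K ∘ ∈verts⇒∈V (connected c d c∈K d∈K)

  private
    avoids-edge : (w : Walk K a b) → s ∉ₗ verts w ⊎ t ∉ₗ verts w →
                  (x , y) ∈ₗ edges w → ¬ SameEdge (x , y) (s , t)
    avoids-edge w (inj₁ s∉w) i = s∉w ∘ proj₁ ∘ SameEdge-∈verts w i ∘ SameEdge-sym
    avoids-edge w (inj₂ t∉w) i = t∉w ∘ proj₂ ∘ SameEdge-∈verts w i ∘ SameEdge-sym

  detour : E K s t ≡ true → Σ (Walk K s t) λ w → ∀ {x y} → (x , y) ∈ₗ edges w → ¬ SameEdge (x , y) (s , t)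
  detour {s = s} {t} e with 2<∣p∣⇒∃-third (proj₁ K-2conn) s t
  ... | c , c∈K , c≢s , c≢t
    with connected-without t t∈K s c s∈K c∈K (E⇒≢ K e) c≢t
       | connected-without s s∈K c t c∈K t∈K c≢s (E⇒≢ K e ∘ sym)
    where
      s∈K = proj₁ (E-V K s t e)
      t∈K = proj₂ (E-V K s t e)
  ... | w₁ , t∉w₁ | w₂ , s∉w₂ = w₁ ++ʷ w₂ , λ i → [ avoids-edge w₁ (inj₂ t∉w₁) , avoids-edge w₂ (inj₁ s∉w₂) ]
                                                    (∈-edges-++ʷ⁻ w₁ w₂ i)

  deleteEdge-connected : E K s t ≡ true → Connected (deleteEdge K s t)
  deleteEdge-connected st∈K c d c∈K d∈K = bypass detourₛₜ (connected c d c∈K d∈K)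
    where
      w = proj₁ (detour st∈K)
      detourₛₜ = transport w (∈verts⇒∈V w) λ i → deleteEdge-E⁺ {K = K} (∈edges⇒E w i) (proj₂ (detour st∈K) i)

  -- The second path avoiding the edge αβ makes the two paths edge-disjoint even when the first one is that edge.
  record DisjointPaths (α β : Fin n) : Set where
    constructor disjointPaths
    field
      path₁ path₂         : Walk K α β
      unique₁             : Unique (verts path₁)
      unique₂             : Unique (verts path₂)
      internally-disjoint : x ∈ₗ verts path₁ → x ∈ₗ verts path₂ → x ≡ α ⊎ x ≡ β
      path₂-avoids-αβ     : (x , y) ∈ₗ edges path₂ → ¬ SameEdge (x , y) (α , β)

  private
    open DecMembership (Fin._≟_ {n}) using (_∈?_)

    edge-and-detour : E K a b ≡ true → DisjointPaths a b
    edge-and-detour {a = a} {b} e with loopErase (proj₁ (detour e))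
    ... | pathWithin p p! p⊆ p⊆ₑ =
      disjointPaths (step e (here b∈K)) p ((E⇒≢ K e ∷ []) ∷ [] ∷ []) p!
        (λ { (hereₗ refl) _ → inj₁ refl ; (thereₗ (hereₗ refl)) _ → inj₂ refl })
        (proj₂ (detour e) ∘ p⊆ₑ)
      where b∈K = proj₂ (E-V K a b e)

    -- Menger's augmenting step: if r runs from z ∈ Ta to y and meets Ta ∪ Tb only at z, then
    -- Ta up to z followed by r, and Tb followed by the edge wy, are disjoint α–y paths.
    extend : ∀ {α w} (Ta Tb : Walk K α w) → Unique (verts Ta) →
             (∀ {x} → x ∈ₗ verts Ta → x ∈ₗ verts Tb → x ≡ α ⊎ x ≡ w) →
             z ∈ₗ verts Ta → (r : Walk K z y) →
             (∀ {x} → x ∈ₗ verts r → x ∈ₗ verts Ta ⊎ x ∈ₗ verts Tb → x ≡ z) →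
             w ∉ₗ verts r → y ≢ α → y ≢ w → α ≢ w → E K w y ≡ true → DisjointPaths α y
    extend {z = z} {y} {α} {w} Ta Tb Ta! Ta∩Tb z∈Ta r r-meets w∉r y≢α y≢w α≢w wy∈K
      with split Ta Ta! z∈Ta
    ... | splitAt pre suf pre⊆ _ _ _ pre∩suf
      with loopErase (pre ++ʷ r) | loopErase (Tb ++ʷ step wy∈K (here (proj₂ (E-V K w y wy∈K))))
    ... | pathWithin p₁ p₁! p₁⊆ _ | pathWithin p₂ p₂! p₂⊆ p₂⊆ₑ =
      disjointPaths p₁ p₂ p₁! p₂! (λ i j → disjoint (p₁⊆ i) (p₂⊆ j)) (avoids ∘ p₂⊆ₑ)
      where
        wy = step wy∈K (here (proj₂ (E-V K w y wy∈K)))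
        w∉pre : w ∉ₗ verts pre
        w∉pre w∈pre = w∉r (subst (_∈ₗ verts r) (sym (pre∩suf w∈pre (end∈verts suf))) (start∈verts r))
        y∉Tb : y ∉ₗ verts Tb
        y∉Tb y∈Tb with r-meets (end∈verts r) (inj₂ y∈Tb)
        ... | refl = [ y≢α , y≢w ] (Ta∩Tb z∈Ta y∈Tb)
        disjoint : x ∈ₗ verts (pre ++ʷ r) → x ∈ₗ verts (Tb ++ʷ wy) → x ≡ α ⊎ x ≡ y
        disjoint i j with ∈-verts-++ʷ⁻ pre r i | ∈-verts-++ʷ⁻ Tb wy j
        ... | _        | inj₂ (thereₗ (hereₗ refl)) = inj₂ refl
        ... | inj₁ x∈pre | inj₂ (hereₗ refl) = ⊥-elim (w∉pre x∈pre)
        ... | inj₂ x∈r   | inj₂ (hereₗ refl) = ⊥-elim (w∉r x∈r)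
        ... | inj₁ x∈pre | inj₁ x∈Tb = [ inj₁ , (λ { refl → ⊥-elim (w∉pre x∈pre) }) ] (Ta∩Tb (pre⊆ x∈pre) x∈Tb)
        ... | inj₂ x∈r   | inj₁ x∈Tb with r-meets x∈r (inj₂ x∈Tb)
        ... | refl = [ inj₁ , (λ { refl → ⊥-elim (w∉r x∈r) }) ] (Ta∩Tb z∈Ta x∈Tb)
        avoids : ∀ {x x′} → (x , x′) ∈ₗ edges (Tb ++ʷ wy) → ¬ SameEdge (x , x′) (α , y)
        avoids i same with ∈-edges-++ʷ⁻ Tb wy i | same
        ... | inj₁ j | inj₁ (refl , refl) = y∉Tb (proj₂ (∈edges⇒∈verts Tb j))
        ... | inj₁ j | inj₂ (refl , refl) = y∉Tb (proj₁ (∈edges⇒∈verts Tb j))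
        ... | inj₂ (hereₗ refl) | inj₁ (refl , refl) = α≢w refl
        ... | inj₂ (hereₗ refl) | inj₂ (refl , refl) = y≢w refl

    -- Induction along W: disjoint paths from a to the successor w of y are extended to y
    -- through an a–y walk avoiding w.
    disjointPaths-along : (W : Walk K y a) → a ∈ V K → y ≢ a → DisjointPaths a y
    disjointPaths-along (here _) _ y≢a = ⊥-elim (y≢a refl)
    disjointPaths-along {y = y} {a = α} (step {w = w} yw∈K W) α∈K y≢α with w Fin.≟ α
    ... | yes refl = edge-and-detour (trans (E-sym K w y) yw∈K)
    ... | no w≢α with disjointPaths-along W α∈K w≢α
    ... | disjointPaths T₁ T₂ T₁! T₂! T₁∩T₂ _
      with connected-without w w∈K α y α∈K y∈K (w≢α ∘ sym) (E⇒≢ K yw∈K)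
      where
        y∈K = proj₁ (E-V K y w yw∈K)
        w∈K = proj₂ (E-V K y w yw∈K)
    ... | R , w∉R
      with first (λ x → (x ∈? verts T₁) ⊎-dec (x ∈? verts T₂)) (reverse R)
                 (lose (∈-verts-reverse⁺ R (start∈verts R)) (inj₁ (start∈verts T₁)))
    ... | firstHit z z∈T₁∪T₂ pre pre-misses pre⊆ _ =
      extend-from (reverse pre) (pre-misses ∘ ∈-verts-reverse⁻ pre)
                  (w∉R ∘ ∈-verts-reverse⁻ R ∘ pre⊆ ∘ ∈-verts-reverse⁻ pre)
      where
        extend-from : (r : Walk K z y) → (∀ {x} → x ∈ₗ verts r → x ∈ₗ verts T₁ ⊎ x ∈ₗ verts T₂ → x ≡ z) →
                      w ∉ₗ verts r → DisjointPaths α y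
        extend-from r r-meets w∉r with z ∈? verts T₂
        ... | yes z∈T₂ = extend T₂ T₁ T₂! (λ i j → T₁∩T₂ j i) z∈T₂ r (λ i → r-meets i ∘ swap) w∉r
                           y≢α (E⇒≢ K yw∈K) (w≢α ∘ sym) (trans (E-sym K w y) yw∈K)
        ... | no z∉T₂ = extend T₁ T₂ T₁! T₁∩T₂ ([ id , ⊥-elim ∘ z∉T₂ ] z∈T₁∪T₂) r r-meets w∉r
                           y≢α (E⇒≢ K yw∈K) (w≢α ∘ sym) (trans (E-sym K w y) yw∈K)

  menger₂ : a ∈ V K → b ∈ V K → a ≢ b → DisjointPaths a b
  menger₂ {a = a} {b = b} a∈K b∈K a≢b = disjointPaths-along (connected b a b∈K a∈K) a∈K (a≢b ∘ sym)

∃-edge-at : TwoConnected K → x ∈ V K → Σ (Fin n) λ y → E K x y ≡ true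
∃-edge-at {x = x} K-2conn x∈K with 2<∣p∣⇒∃-third (proj₁ K-2conn) x x
... | y , y∈K , y≢x , _ with proj₁ (proj₂ K-2conn) x y x∈K y∈K
... | here _ = ⊥-elim (y≢x refl)
... | step {w = w} e _ = w , e

ConnectedWithout⇒Connected : 3 ≤ ∣ V H ∣ → (∀ x → x ∈ V H → ConnectedWithout H x) → Connected H
ConnectedWithout⇒Connected 3≤∣H∣ connected-without u v u∈H v∈H with 2<∣p∣⇒∃-third 3≤∣H∣ u v
... | x , x∈H , x≢u , x≢v = proj₁ (connected-without x x∈H u v u∈H v∈H (x≢u ∘ sym) (x≢v ∘ sym))

-- Blocks
module _ {G B : Graph n} (B-block : TwoConnectedBlock B G) where

  private
    B⊑G = proj₁ B-block
    B-2conn = proj₁ (proj₂ B-block)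

  module _ (p : Walk G a b) (p! : Unique (verts p)) (a∈B : a ∈ V B) (b∈B : b ∈ V B) where

    private
      open DecMembership (Fin._≟_ {n}) using (_∈?_)
      B+p = addWalk B p

      along-p : (w : Walk G u v) → verts w ⊆ₗ verts p →
                (∀ {x y} → (x , y) ∈ₗ edges w → (x , y) ∈ₗ edges p ⊎ (y , x) ∈ₗ edges p) →
                Σ (Walk B+p u v) λ w′ → verts w′ ≡ verts w
      along-p w ⊆v ⊆e = transport w ∈V ∈E , verts-transport {K = B+p} w ∈V ∈E
        where
          ∈V : x ∈ₗ verts w → x ∈ V B+p
          ∈V = ∈verts⇒∈V-addWalk B p ∘ ⊆v
          ∈E : (x , y) ∈ₗ edges w → E B+p x y ≡ true
          ∈E = ∈edges⇒E-addWalk B p ∘ ⊆e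

      -- x lies on at most one side of u along the path p, so p leads from u to a or to b avoiding x.
      reach-B : u ∈ V B+p → u ≢ x → Σ (Fin n) λ c → c ∈ V B × c ≢ x × Σ (Walk B+p u c) λ w → x ∉ₗ verts w
      reach-B {u = u} {x} u∈B+p u≢x with u ∈ₛ? V B
      ... | yes u∈B = u , u∈B , u≢x , here (proj₁ (⊑-addWalk B p) u∈B) , λ { (hereₗ refl) → u≢x refl }
      ... | no u∉B with x∈p∪q⁻ (V B) _ u∈B+p
      ... | inj₁ u∈B = ⊥-elim (u∉B u∈B)
      ... | inj₂ u∈p with split p p! (∈-fromList⁻ _ u∈p)
      ... | splitAt pre suf pre⊆ pre⊆ₑ suf⊆ suf⊆ₑ pre∩suf with x ∈? verts suf
      ... | no x∉suf with along-p suf suf⊆ (inj₁ ∘ suf⊆ₑ)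
      ... | w , w≡suf = b , b∈B , (λ { refl → x∉suf (end∈verts suf) }) , w , x∉suf ∘ subst (x ∈ₗ_) w≡suf
      reach-B {u = u} {x} _ u≢x | no _ | inj₂ _ | splitAt pre suf pre⊆ pre⊆ₑ _ _ pre∩suf | yes x∈suf
        with along-p (reverse pre) (pre⊆ ∘ ∈-verts-reverse⁻ pre) (inj₂ ∘ pre⊆ₑ ∘ ∈-edges-reverse⁻ pre)
      ... | w , w≡pre = a , a∈B , (λ { refl → x∉pre (start∈verts pre) }) , w ,
                        x∉pre ∘ ∈-verts-reverse⁻ pre ∘ subst (x ∈ₗ_) w≡pre
        where
          x∉pre : x ∉ₗ verts pre
          x∉pre x∈pre = u≢x (sym (pre∩suf x∈pre x∈suf))

      without : ∀ x → x ∈ V B+p → ConnectedWithout B+p x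
      without x _ u v u∈B+p v∈B+p u≢x v≢x with reach-B u∈B+p u≢x | reach-B v∈B+p v≢x
      ... | c , c∈B , c≢x , w₁ , x∉w₁ | d , d∈B , d≢x , w₂ , x∉w₂ with walk-avoiding B-2conn c∈B d∈B c≢x d≢x
      ... | m , x∉m = w₁ ++ʷ (weaken (⊑-addWalk B p) m ++ʷ reverse w₂) , x∉
        where
          x∉ : x ∉ₗ verts (w₁ ++ʷ (weaken (⊑-addWalk B p) m ++ʷ reverse w₂))
          x∉ i with ∈-verts-++ʷ⁻ w₁ _ i
          ... | inj₁ j = x∉w₁ j
          ... | inj₂ j with ∈-verts-++ʷ⁻ (weaken (⊑-addWalk B p) m) _ j
          ... | inj₁ k = x∉m (subst (x ∈ₗ_) (verts-weaken (⊑-addWalk B p) m) k)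
          ... | inj₂ k = x∉w₂ (∈-verts-reverse⁻ w₂ k)

    addWalk-2connected : TwoConnected (addWalk B p)
    addWalk-2connected = 3≤∣B+p∣ , ConnectedWithout⇒Connected 3≤∣B+p∣ without , without
      where
        3≤∣B+p∣ = ℕ.≤-trans (proj₁ B-2conn) (p⊆q⇒∣p∣≤∣q∣ (proj₁ (⊑-addWalk B p)))

  ¬ear : (p : Walk G a b) → Unique (verts p) → a ∈ V B → b ∈ V B →
         (x , y) ∈ₗ edges p → E B x y ≡ false → ⊥
  ¬ear {x = x} {y = y} p p! a∈B b∈B xy∈p xy∉B =
    proj₂ (proj₂ B-block) (addWalk B p) (addWalk-⊑ B p B⊑G)
      (⊑-addWalk B p , inj₂ (x , y , ∈edges⇒E-addWalk B p (inj₁ xy∈p) , xy∉B))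
      (addWalk-2connected p p! a∈B b∈B)

  OffBlock : Walk G a b → Set
  OffBlock w = ∀ {x y} → (x , y) ∈ₗ edges w → E B x y ≡ false

  MeetsBlockOnlyAt : Walk G a b → Fin n → Set
  MeetsBlockOnlyAt w c = ∀ {x} → x ∈ₗ verts w → x ∈ V B → x ≡ c

  meetsOnce⇒OffBlock : (w : Walk G a b) → MeetsBlockOnlyAt w c → OffBlock w
  meetsOnce⇒OffBlock w meets {x} {y} xy∈w with E B x y in xy∈B
  ... | false = refl
  ... | true with meets (proj₁ (∈edges⇒∈verts w xy∈w)) (proj₁ (E-V B x y xy∈B))
                | meets (proj₂ (∈edges⇒∈verts w xy∈w)) (proj₂ (E-V B x y xy∈B))
  ... | refl | refl = ⊥-elim (E⇒≢ G (∈edges⇒E w xy∈w) refl)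

  missesBlock⇒OffBlock : (w : Walk G a b) → ¬ Any (_∈ V B) (verts w) → OffBlock w
  missesBlock⇒OffBlock {a = a} w w∌B =
    meetsOnce⇒OffBlock {c = a} w λ x∈w x∈B → ⊥-elim (w∌B (lose x∈w x∈B))

  -- Two different first contacts with B would close an ear onto B.
  first-contact-unique : (w₁ : Walk G u c) (w₂ : Walk G u d) → c ∈ V B → d ∈ V B →
                         MeetsBlockOnlyAt w₁ c → MeetsBlockOnlyAt w₂ d → c ≡ d
  first-contact-unique {c = c} {d = d} w₁ w₂ c∈B d∈B meets₁ meets₂ with c Fin.≟ d
  ... | yes c≡d = c≡d
  ... | no c≢d with loopErase (reverse w₁ ++ʷ w₂)
  ... | pathWithin (here _) _ _ _ = ⊥-elim (c≢d refl)
  ... | pathWithin q@(step _ _) q! _ q⊆ₑ = ⊥-elim (¬ear q q! c∈B d∈B (hereₗ refl) (off (q⊆ₑ (hereₗ refl))))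
    where
      off : OffBlock (reverse w₁ ++ʷ w₂)
      off i with ∈-edges-++ʷ⁻ (reverse w₁) w₂ i
      ... | inj₁ j = trans (E-sym B _ _) (meetsOnce⇒OffBlock w₁ meets₁ (∈-edges-reverse⁻ w₁ j))
      ... | inj₂ j = meetsOnce⇒OffBlock w₂ meets₂ j

  record Passage (P : Walk G u v) : Set where
    constructor passage
    field
      entry exit        : Fin n
      entry∈B           : entry ∈ V B
      exit∈B            : exit ∈ V B
      approach          : Walk G u entry
      departure         : Walk G exit v
      approach-meets    : MeetsBlockOnlyAt approach entry
      departure-meets   : MeetsBlockOnlyAt departure exit
      verts-approach⊆   : verts approach ⊆ₗ verts P
      edges-approach⊆   : edges approach ⊆ₗ edges P
      verts-departure⊆  : verts departure ⊆ₗ verts P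
      edges-departure⊆  : edges departure ⊆ₗ edges P

  passes : (P : Walk G u v) → Any (_∈ V B) (verts P) → Passage P
  passes P meets with find meets
  ... | x , x∈P , x∈B
    with first (_∈ₛ? V B) P meets | first (_∈ₛ? V B) (reverse P) (lose (∈-verts-reverse⁺ P x∈P) x∈B)
  ... | firstHit α α∈B A A-meets A⊆ A⊆ₑ | firstHit β β∈B D D-meets D⊆ D⊆ₑ =
    passage α β α∈B β∈B A (reverse D) A-meets (D-meets ∘ ∈-verts-reverse⁻ D) A⊆ A⊆ₑ
      (∈-verts-reverse⁻ P ∘ D⊆ ∘ ∈-verts-reverse⁻ D)
      (∈-edges-reverse⁻ P ∘ D⊆ₑ ∘ ∈-edges-reverse⁻ D)

-- Q-disjoint paths
QDisjoint-sym : ∀ {Q} (p q : Path H u v) → QDisjoint Q u v p q → QDisjoint Q u v q p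
QDisjoint-sym p q (edge-disjoint , vertex-disjoint) =
  (λ e e′ e∈q e′∈p → edge-disjoint e′ e e′∈p e∈q ∘ SameEdge-sym) ,
  (λ x x∈Q x≢u x≢v x∈q x∈p → vertex-disjoint x x∈Q x≢u x≢v x∈p x∈q)

QDisjoint-common∈R : ∀ {R Q} → Q ∪ R ≡ V H → (P₁ P₂ : Path H u v) → QDisjoint Q u v P₁ P₂ → u ∈ R → v ∈ R →
                     x ∈ₗ verts (proj₁ P₁) → x ∈ₗ verts (proj₁ P₂) → x ∈ R
QDisjoint-common∈R {u = u} {v} {x} {R} {Q} Q∪R≡V P₁ P₂ (_ , vertex-disjoint) u∈R v∈R x∈P₁ x∈P₂ with x ∈ₛ? Q
... | no x∉Q = [ ⊥-elim ∘ x∉Q , id ] (x∈p∪q⁻ Q R (subst (x ∈_) (sym Q∪R≡V) (∈verts⇒∈V (proj₁ P₁) x∈P₁)))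
... | yes x∈Q with x Fin.≟ u | x Fin.≟ v
...   | yes refl | _        = u∈R
...   | no _     | yes refl = v∈R
...   | no x≢u   | no x≢v   = ⊥-elim (vertex-disjoint x x∈Q x≢u x≢v x∈P₁ x∈P₂)

QDisjoint⇒λQ≥2 : ∀ {Q} (p q : Path H u v) → QDisjoint Q u v p q → λQ≥ H Q u v 2
QDisjoint⇒λQ≥2 p q pq = paths , disjoint
  where
    paths : Fin 2 → Path _ _ _
    paths zero = p
    paths (suc zero) = q
    disjoint : ∀ i j → i ≢ j → QDisjoint _ _ _ (paths i) (paths j)
    disjoint zero zero i≢j = ⊥-elim (i≢j refl)
    disjoint zero (suc zero) _ = pq
    disjoint (suc zero) zero _ = QDisjoint-sym p q pq
    disjoint (suc zero) (suc zero) i≢j = ⊥-elim (i≢j refl)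

QDisjoint-transfer : ∀ {Q} (P₁ P₂ : Path H u v) → QDisjoint Q u v P₁ P₂ → (W₁ W₂ : Walk K u v) →
                     (∀ {x} → x ∈ₗ verts W₁ → x ∈ₗ verts W₂ → x ∈ₗ verts (proj₁ P₁) × x ∈ₗ verts (proj₁ P₂)) →
                     (∀ {e e′} → e ∈ₗ edges W₁ → e′ ∈ₗ edges W₂ → SameEdge e e′ →
                        e ∈ₗ edges (proj₁ P₁) × e′ ∈ₗ edges (proj₁ P₂)) →
                     λQ≥ K Q u v 2
QDisjoint-transfer P₁ P₂ (edge-disjoint , vertex-disjoint) W₁ W₂ common-verts common-edges
  with loopErase W₁ | loopErase W₂
... | pathWithin p₁ p₁! p₁⊆ p₁⊆ₑ | pathWithin p₂ p₂! p₂⊆ p₂⊆ₑ =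
  QDisjoint⇒λQ≥2 (p₁ , p₁!) (p₂ , p₂!)
    ( (λ e e′ e∈p₁ e′∈p₂ same → let e∈P₁ , e′∈P₂ = common-edges (p₁⊆ₑ e∈p₁) (p₂⊆ₑ e′∈p₂) same
                                in edge-disjoint e e′ e∈P₁ e′∈P₂ same)
    , (λ x x∈Q x≢u x≢v x∈p₁ x∈p₂ → let x∈P₁ , x∈P₂ = common-verts (p₁⊆ x∈p₁) (p₂⊆ x∈p₂)
                                    in vertex-disjoint x x∈Q x≢u x≢v x∈P₁ x∈P₂))

-- Deleting an edge of a block
record BlockWalk (B K : Graph n) (α β : Fin n) : Set where
  constructor blockWalk
  field
    walk    : Walk K α β
    verts⊆B : x ∈ₗ verts walk → x ∈ V B
    edges⊆B : (x , y) ∈ₗ edges walk → E B x y ≡ true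
open BlockWalk

record BlockLinkage (B K : Graph n) (α β : Fin n) : Set where
  constructor blockLinkage
  field
    route₁ route₂       : BlockWalk B K α β
    internally-disjoint : x ∈ₗ verts (walk route₁) → x ∈ₗ verts (walk route₂) → x ≡ α ⊎ x ≡ β
    edge-disjoint       : ∀ {e e′} → e ∈ₗ edges (walk route₁) → e′ ∈ₗ edges (walk route₂) → ¬ SameEdge e e′

BlockLinked : (B K : Graph n) → Subset n → Set
BlockLinked B K R = ∀ {α β} → α ≢ β → α ∈ R → β ∈ R → α ∈ V B → β ∈ V B → BlockLinkage B K α β

module _ {G B : Graph n} (B-block : TwoConnectedBlock B G) {s t : Fin n} (st∈B : E B s t ≡ true) where

  private
    Gₛₜ = deleteEdge G s t
    B⊑G = proj₁ B-block
    B-2conn = proj₁ (proj₂ B-block)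

  module _ {H : Graph n} (H⊑B : H ⊑ B) (st∉H : ∀ {x y} → E H x y ≡ true → ¬ SameEdge (x , y) (s , t)) where

    private
      ∈V : (w : Walk H a b) → x ∈ₗ verts w → x ∈ V Gₛₜ
      ∈V w = proj₁ B⊑G ∘ proj₁ H⊑B ∘ ∈verts⇒∈V w
      ∈E : (w : Walk H a b) → (x , y) ∈ₗ edges w → E Gₛₜ x y ≡ true
      ∈E w i = deleteEdge-E⁺ {K = G} (proj₂ B⊑G _ _ (proj₂ H⊑B _ _ (∈edges⇒E w i))) (st∉H (∈edges⇒E w i))

    toBlockWalk : Walk H a b → BlockWalk B Gₛₜ a b
    toBlockWalk w = blockWalk (transport w (∈V w) (∈E w))
      (proj₁ H⊑B ∘ ∈verts⇒∈V w ∘ subst (_ ∈ₗ_) (verts-transport {K = Gₛₜ} w (∈V w) (∈E w)))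
      (proj₂ H⊑B _ _ ∘ ∈edges⇒E w ∘ subst (_ ∈ₗ_) (edges-transport {K = Gₛₜ} w (∈V w) (∈E w)))

    verts-toBlockWalk : (w : Walk H a b) → verts (walk (toBlockWalk w)) ≡ verts w
    verts-toBlockWalk w = verts-transport {K = Gₛₜ} w (∈V w) (∈E w)

    edges-toBlockWalk : (w : Walk H a b) → edges (walk (toBlockWalk w)) ≡ edges w
    edges-toBlockWalk w = edges-transport {K = Gₛₜ} w (∈V w) (∈E w)

    linkage : TwoConnected H → a ∈ V H → b ∈ V H → a ≢ b → BlockLinkage B Gₛₜ a b
    linkage H-2conn a∈H b∈H a≢b with menger₂ H-2conn a∈H b∈H a≢b
    ... | disjointPaths T₁ T₂ _ _ T₁∩T₂ T₂-avoids =
      blockLinkage (toBlockWalk T₁) (toBlockWalk T₂)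
        (λ i j → T₁∩T₂ (subst (_ ∈ₗ_) (verts-toBlockWalk T₁) i) (subst (_ ∈ₗ_) (verts-toBlockWalk T₂) j))
        (λ i j → edge-disjoint (subst (_ ∈ₗ_) (edges-toBlockWalk T₁) i) (subst (_ ∈ₗ_) (edges-toBlockWalk T₂) j))
      where
        -- A common edge would have both ends in T₁ ∩ T₂ = {a, b}, so it would be the edge ab, which T₂ avoids.
        edge-disjoint : ∀ {e e′} → e ∈ₗ edges T₁ → e′ ∈ₗ edges T₂ → ¬ SameEdge e e′
        edge-disjoint {x , y} i j same = ends (T₁∩T₂ x∈T₁ x∈T₂) (T₁∩T₂ y∈T₁ y∈T₂)
          where
            x∈T₁ = proj₁ (∈edges⇒∈verts T₁ i)
            y∈T₁ = proj₂ (∈edges⇒∈verts T₁ i)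
            x∈T₂ = proj₁ (SameEdge-∈verts T₂ j same)
            y∈T₂ = proj₂ (SameEdge-∈verts T₂ j same)
            ends : x ≡ _ ⊎ x ≡ _ → y ≡ _ ⊎ y ≡ _ → ⊥
            ends (inj₁ refl) (inj₁ refl) = E⇒≢ H (∈edges⇒E T₁ i) refl
            ends (inj₂ refl) (inj₂ refl) = E⇒≢ H (∈edges⇒E T₁ i) refl
            ends (inj₁ refl) (inj₂ refl) = T₂-avoids j (SameEdge-sym same)
            ends (inj₂ refl) (inj₁ refl) = T₂-avoids j (SameEdge-flipʳ (SameEdge-sym same))

  throughBlock : a ∈ V B → b ∈ V B → BlockWalk B Gₛₜ a b
  throughBlock a∈B b∈B =
    toBlockWalk (deleteEdge-⊑ {K = B}) (deleteEdge-¬E {K = B}) (deleteEdge-connected B-2conn st∈B _ _ a∈B b∈B)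

  private
    offBlock⇒E : ∀ {w : Walk G a b} → OffBlock B-block w → (x , y) ∈ₗ edges w → E Gₛₜ x y ≡ true
    offBlock⇒E {w = w} off i =
      deleteEdge-E⁺ {K = G} (∈edges⇒E w i) λ same → b≡true⇒b≢false (SameEdge-E B same st∈B) (off i)

  offBlockWalk : (w : Walk G a b) → OffBlock B-block w → Walk Gₛₜ a b
  offBlockWalk w off = transport w (∈verts⇒∈V w) (offBlock⇒E off)

  verts-offBlockWalk : (w : Walk G a b) (off : OffBlock B-block w) → verts (offBlockWalk w off) ≡ verts w
  verts-offBlockWalk w off = verts-transport {K = Gₛₜ} w (∈verts⇒∈V w) (offBlock⇒E off)

  edges-offBlockWalk : (w : Walk G a b) (off : OffBlock B-block w) → edges (offBlockWalk w off) ≡ edges w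
  edges-offBlockWalk w off = edges-transport {K = Gₛₜ} w (∈verts⇒∈V w) (offBlock⇒E off)

  record Rerouted (P : Walk G u v) (T : Walk Gₛₜ a b) : Set where
    constructor rerouted
    field
      walk   : Walk Gₛₜ u v
      verts⊆ : x ∈ₗ verts walk → (x ∈ₗ verts P × (x ∈ V B → x ≡ a ⊎ x ≡ b)) ⊎ x ∈ₗ verts T
      edges⊆ : (x , y) ∈ₗ edges walk → ((x , y) ∈ₗ edges P × E B x y ≡ false) ⊎ (x , y) ∈ₗ edges T

  reroute : (P : Walk G u v) (π : Passage B-block P) →
            (T : Walk Gₛₜ (Passage.entry π) (Passage.exit π)) → Rerouted P T
  reroute P (passage α β _ _ A D A-meets D-meets A⊆ A⊆ₑ D⊆ D⊆ₑ) T = rerouted (A′ ++ʷ (T ++ʷ D′)) verts⊆ edges⊆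
    where
      A-off = meetsOnce⇒OffBlock B-block A A-meets
      D-off = meetsOnce⇒OffBlock B-block D D-meets
      A′ = offBlockWalk A A-off
      D′ = offBlockWalk D D-off
      verts⊆ : x ∈ₗ verts (A′ ++ʷ (T ++ʷ D′)) → (x ∈ₗ verts P × (x ∈ V B → x ≡ α ⊎ x ≡ β)) ⊎ x ∈ₗ verts T
      verts⊆ i with ∈-verts-++ʷ⁻ A′ _ i
      ... | inj₁ j = let j′ = subst (_ ∈ₗ_) (verts-offBlockWalk A A-off) j in inj₁ (A⊆ j′ , inj₁ ∘ A-meets j′)
      ... | inj₂ j with ∈-verts-++ʷ⁻ T D′ j
      ... | inj₁ k = inj₂ k
      ... | inj₂ k = let k′ = subst (_ ∈ₗ_) (verts-offBlockWalk D D-off) k in inj₁ (D⊆ k′ , inj₂ ∘ D-meets k′)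
      edges⊆ : (x , y) ∈ₗ edges (A′ ++ʷ (T ++ʷ D′)) → ((x , y) ∈ₗ edges P × E B x y ≡ false) ⊎ (x , y) ∈ₗ edges T
      edges⊆ i with ∈-edges-++ʷ⁻ A′ _ i
      ... | inj₁ j = let j′ = subst (_ ∈ₗ_) (edges-offBlockWalk A A-off) j in inj₁ (A⊆ₑ j′ , A-off j′)
      ... | inj₂ j with ∈-edges-++ʷ⁻ T D′ j
      ... | inj₁ k = inj₂ k
      ... | inj₂ k = let k′ = subst (_ ∈ₗ_) (edges-offBlockWalk D D-off) k in inj₁ (D⊆ₑ k′ , D-off k′)

  trivialLinkage : a ∈ V B → BlockLinkage B Gₛₜ a a
  trivialLinkage a∈B = blockLinkage stay stay (λ { (hereₗ refl) _ → inj₁ refl }) (λ ())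
    where
      stay = blockWalk (here (proj₁ B⊑G a∈B)) (λ { (hereₗ refl) → a∈B }) (λ ())

  module _ {Q : Subset n} (P₁ P₂ : Path G u v) (P₁∥P₂ : QDisjoint Q u v P₁ P₂) where

    private
      p₁ = proj₁ P₁
      p₂ = proj₁ P₂

    reroute-none : ¬ Any (_∈ V B) (verts p₁) → ¬ Any (_∈ V B) (verts p₂) → λQ≥ Gₛₜ Q u v 2
    reroute-none p₁∌B p₂∌B =
      QDisjoint-transfer P₁ P₂ P₁∥P₂ (offBlockWalk p₁ off₁) (offBlockWalk p₂ off₂)
        (λ i j → subst (_ ∈ₗ_) (verts-offBlockWalk p₁ off₁) i , subst (_ ∈ₗ_) (verts-offBlockWalk p₂ off₂) j)
        (λ i j _ → subst (_ ∈ₗ_) (edges-offBlockWalk p₁ off₁) i , subst (_ ∈ₗ_) (edges-offBlockWalk p₂ off₂) j)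
      where
        off₁ = missesBlock⇒OffBlock B-block p₁ p₁∌B
        off₂ = missesBlock⇒OffBlock B-block p₂ p₂∌B

    reroute-both : (L : BlockLinkage B Gₛₜ a b) →
                   Rerouted p₁ (walk (BlockLinkage.route₁ L)) → Rerouted p₂ (walk (BlockLinkage.route₂ L)) →
                   a ∈ₗ verts p₁ → a ∈ₗ verts p₂ → b ∈ₗ verts p₁ → b ∈ₗ verts p₂ → λQ≥ Gₛₜ Q u v 2
    reroute-both {a = α} {β} (blockLinkage T₁ T₂ T₁∩T₂ T₁∥T₂) (rerouted W₁ W₁⊆ W₁⊆ₑ) (rerouted W₂ W₂⊆ W₂⊆ₑ)
                 α∈p₁ α∈p₂ β∈p₁ β∈p₂ =
      QDisjoint-transfer P₁ P₂ P₁∥P₂ W₁ W₂ common-verts common-edges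
      where
        ends : x ≡ α ⊎ x ≡ β → x ∈ₗ verts p₁ × x ∈ₗ verts p₂
        ends (inj₁ refl) = α∈p₁ , α∈p₂
        ends (inj₂ refl) = β∈p₁ , β∈p₂
        common-verts : x ∈ₗ verts W₁ → x ∈ₗ verts W₂ → x ∈ₗ verts p₁ × x ∈ₗ verts p₂
        common-verts i j with W₁⊆ i | W₂⊆ j
        ... | inj₁ (x∈p₁ , _)    | inj₁ (x∈p₂ , _)    = x∈p₁ , x∈p₂
        ... | inj₁ (_ , x∈B⇒end) | inj₂ x∈T₂          = ends (x∈B⇒end (verts⊆B T₂ x∈T₂))
        ... | inj₂ x∈T₁          | inj₁ (_ , x∈B⇒end) = ends (x∈B⇒end (verts⊆B T₁ x∈T₁))
        ... | inj₂ x∈T₁          | inj₂ x∈T₂          = ends (T₁∩T₂ x∈T₁ x∈T₂)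
        common-edges : ∀ {e e′} → e ∈ₗ edges W₁ → e′ ∈ₗ edges W₂ → SameEdge e e′ → e ∈ₗ edges p₁ × e′ ∈ₗ edges p₂
        common-edges {x , y} {x′ , y′} i j same with W₁⊆ₑ i | W₂⊆ₑ j
        ... | inj₁ (e∈p₁ , _) | inj₁ (e′∈p₂ , _) = e∈p₁ , e′∈p₂
        ... | inj₁ (_ , e∉B)  | inj₂ e′∈T₂ = ⊥-elim (b≡true⇒b≢false (SameEdge-E B same (edges⊆B T₂ e′∈T₂)) e∉B)
        ... | inj₂ e∈T₁       | inj₁ (_ , e′∉B) =
          ⊥-elim (b≡true⇒b≢false (SameEdge-E B (SameEdge-sym same) (edges⊆B T₁ e∈T₁)) e′∉B)
        ... | inj₂ e∈T₁       | inj₂ e′∈T₂ = ⊥-elim (T₁∥T₂ e∈T₁ e′∈T₂ same)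

    reroute-one : (T : BlockWalk B Gₛₜ a b) → Rerouted p₁ (walk T) → ¬ Any (_∈ V B) (verts p₂) → λQ≥ Gₛₜ Q u v 2
    reroute-one T (rerouted W₁ W₁⊆ W₁⊆ₑ) p₂∌B =
      QDisjoint-transfer P₁ P₂ P₁∥P₂ W₁ W₂ common-verts common-edges
      where
        p₂-off = missesBlock⇒OffBlock B-block p₂ p₂∌B
        W₂ = offBlockWalk p₂ p₂-off
        common-verts : x ∈ₗ verts W₁ → x ∈ₗ verts W₂ → x ∈ₗ verts p₁ × x ∈ₗ verts p₂
        common-verts i j with subst (_ ∈ₗ_) (verts-offBlockWalk p₂ p₂-off) j | W₁⊆ i
        ... | x∈p₂ | inj₁ (x∈p₁ , _) = x∈p₁ , x∈p₂
        ... | x∈p₂ | inj₂ x∈T = ⊥-elim (p₂∌B (lose x∈p₂ (verts⊆B T x∈T)))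
        common-edges : ∀ {e e′} → e ∈ₗ edges W₁ → e′ ∈ₗ edges W₂ → SameEdge e e′ → e ∈ₗ edges p₁ × e′ ∈ₗ edges p₂
        common-edges {x , y} {x′ , y′} i j same with subst (_ ∈ₗ_) (edges-offBlockWalk p₂ p₂-off) j | W₁⊆ₑ i
        ... | e′∈p₂ | inj₁ (e∈p₁ , _) = e∈p₁ , e′∈p₂
        ... | e′∈p₂ | inj₂ e∈T =
          ⊥-elim (b≡true⇒b≢false (SameEdge-E B (SameEdge-sym same) (edges⊆B T e∈T)) (p₂-off e′∈p₂))

  λQ≥1-deleteEdge : ∀ {Q} → λQ≥ G Q u v 1 → λQ≥ Gₛₜ Q u v 1
  λQ≥1-deleteEdge (paths , _) with loopErase (bypass (walk (throughBlock s∈B t∈B)) (proj₁ (paths zero)))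
    where
      s∈B = proj₁ (E-V B s t st∈B)
      t∈B = proj₂ (E-V B s t st∈B)
  ... | pathWithin p p! _ _ = (λ _ → p , p!) , λ { zero zero 0≢0 → ⊥-elim (0≢0 refl) }

  module _ {R Q : Subset n} (Q∪R≡V : Q ∪ R ≡ V G) (links : BlockLinked B Gₛₜ R) where

    private
      links′ : a ∈ R → b ∈ R → a ∈ V B → b ∈ V B → BlockLinkage B Gₛₜ a b
      links′ {a = a} {b} a∈R b∈R a∈B b∈B with a Fin.≟ b
      ... | yes refl = trivialLinkage a∈B
      ... | no a≢b = links a≢b a∈R b∈R a∈B b∈B

      pair-deleteEdge : u ∈ R → v ∈ R → (P₁ P₂ : Path G u v) → QDisjoint Q u v P₁ P₂ → λQ≥ Gₛₜ Q u v 2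
      pair-deleteEdge u∈R v∈R P₁ P₂ P₁∥P₂
        with any? (_∈ₛ? V B) (verts (proj₁ P₁)) | any? (_∈ₛ? V B) (verts (proj₁ P₂))
      ... | no p₁∌B | no p₂∌B = reroute-none P₁ P₂ P₁∥P₂ p₁∌B p₂∌B
      ... | yes p₁∋B | no p₂∌B with passes B-block (proj₁ P₁) p₁∋B
      ... | π@(passage _ _ α∈B β∈B _ _ _ _ _ _ _ _) =
        reroute-one P₁ P₂ P₁∥P₂ T (reroute (proj₁ P₁) π (walk T)) p₂∌B
        where T = throughBlock α∈B β∈B
      pair-deleteEdge u∈R v∈R P₁ P₂ P₁∥P₂ | no p₁∌B | yes p₂∋B with passes B-block (proj₁ P₂) p₂∋B
      ... | π@(passage _ _ α∈B β∈B _ _ _ _ _ _ _ _) =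
        reroute-one P₂ P₁ (QDisjoint-sym P₁ P₂ P₁∥P₂) T (reroute (proj₁ P₂) π (walk T)) p₁∌B
        where T = throughBlock α∈B β∈B
      pair-deleteEdge u∈R v∈R P₁ P₂ P₁∥P₂ | yes p₁∋B | yes p₂∋B
        with passes B-block (proj₁ P₁) p₁∋B | passes B-block (proj₁ P₂) p₂∋B
      ... | π₁@(passage α β α∈B β∈B A₁ D₁ A₁-meets D₁-meets A₁⊆ _ D₁⊆ _)
          | π₂@(passage α₂ β₂ α₂∈B β₂∈B A₂ D₂ A₂-meets D₂-meets A₂⊆ _ D₂⊆ _)
        with first-contact-unique B-block A₁ A₂ α∈B α₂∈B A₁-meets A₂-meets
           | first-contact-unique B-block (reverse D₁) (reverse D₂) β∈B β₂∈B
               (D₁-meets ∘ ∈-verts-reverse⁻ D₁) (D₂-meets ∘ ∈-verts-reverse⁻ D₂)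
      ... | refl | refl =
        reroute-both P₁ P₂ P₁∥P₂ L (reroute (proj₁ P₁) π₁ _) (reroute (proj₁ P₂) π₂ _)
          (A₁⊆ (end∈verts A₁)) (A₂⊆ (end∈verts A₂)) (D₁⊆ (start∈verts D₁)) (D₂⊆ (start∈verts D₂))
        where
          common∈R : ∀ {x} → x ∈ₗ verts (proj₁ P₁) → x ∈ₗ verts (proj₁ P₂) → x ∈ R
          common∈R = QDisjoint-common∈R Q∪R≡V P₁ P₂ P₁∥P₂ u∈R v∈R
          L = links′ (common∈R (A₁⊆ (end∈verts A₁)) (A₂⊆ (end∈verts A₂)))
                     (common∈R (D₁⊆ (start∈verts D₁)) (D₂⊆ (start∈verts D₂))) α∈B β∈B

    λQ≥-deleteEdge : u ∈ R → v ∈ R → ∀ k → k ≡ 1 ⊎ k ≡ 2 → λQ≥ G Q u v k → λQ≥ Gₛₜ Q u v k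
    λQ≥-deleteEdge _ _ _ (inj₁ refl) λ≥1 = λQ≥1-deleteEdge λ≥1
    λQ≥-deleteEdge u∈R v∈R _ (inj₂ refl) (paths , disjoint) =
      pair-deleteEdge u∈R v∈R (paths zero) (paths (suc zero)) (disjoint zero (suc zero) λ ())

    RQConnected-deleteEdge : ∀ {r} → RQConnected G r R Q → (∀ u v → u ∈ R → v ∈ R → r u v ≡ 0 ⊎ r u v ≡ 1 ⊎ r u v ≡ 2) →
                             RQConnected Gₛₜ r R Q
    RQConnected-deleteEdge {r} G-conn r≤2 u v u∈R v∈R 0<r with r≤2 u v u∈R v∈R
    ... | inj₁ r≡0 = ⊥-elim (ℕ.<-irrefl (sym r≡0) 0<r)
    ... | inj₂ r≡1⊎2 = λQ≥-deleteEdge u∈R v∈R (r u v) r≡1⊎2 (G-conn u v u∈R v∈R 0<r)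

⊏⇒∃-missingEdge : (∀ x → x ∈ V K → Σ (Fin n) λ y → E K x y ≡ true) → H ⊏ K →
                  Σ (Fin n) λ s → Σ (Fin n) λ t → E K s t ≡ true × E H s t ≡ false
⊏⇒∃-missingEdge _ (_ , inj₂ missing) = missing
⊏⇒∃-missingEdge {H = H} edge-at (_ , inj₁ (x , x∈K , x∉H)) with edge-at x x∈K
... | y , xy∈K with E H x y in xy∈H
... | false = x , y , xy∈K , xy∈H
... | true = ⊥-elim (x∉H (proj₁ (E-V H x y xy∈H)))

lemma5 : ∀ {n} (G : Graph n) (r : Fin n → Fin n → ℕ) (R Q : Subset n) →
    MinRQConnected G r R Q →
    (∀ u v → u ∈ R → v ∈ R → (r u v ≡ 0 ⊎ r u v ≡ 1 ⊎ r u v ≡ 2)) →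
    Q ∪ R ≡ V G →
    (G' : Graph n) → TwoConnectedBlock G' G →
    (2 ≤ ∣ R ∩ V G' ∣) ×
    ¬ (Σ (Graph n) λ H → H ⊏ G' × TwoConnected H × (R ∩ V G') ⊆ V H)
lemma5 {n} G r R Q (G-conn , G-minimal) r≤2 Q∪R≡V B B-block = two-terminals , no-smaller-2connected
  where
    B-2conn = proj₁ (proj₂ B-block)

    undeletable : ∀ {s t} → E B s t ≡ true → ¬ BlockLinked B (deleteEdge G s t) R
    undeletable st∈B links = G-minimal _ (deleteEdge-⊏ {K = G} (proj₂ (proj₁ B-block) _ _ st∈B))
                               (RQConnected-deleteEdge {G = G} B-block st∈B Q∪R≡V links G-conn r≤2)

    two-terminals : 2 ≤ ∣ R ∩ V B ∣
    two-terminals with 2 ≤? ∣ R ∩ V B ∣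
    ... | yes 2≤∣R′∣ = 2≤∣R′∣
    ... | no 2≰∣R′∣ with 0<∣p∣⇒Nonempty (ℕ.≤-trans (s≤s z≤n) (proj₁ B-2conn))
    ... | x , x∈B with ∃-edge-at B-2conn x∈B
    ... | y , xy∈B = ⊥-elim (undeletable xy∈B λ α≢β α∈R β∈R α∈B β∈B →
                       ⊥-elim (2≰∣R′∣ (a≢b∧a,b∈p⇒2≤∣p∣ α≢β (x∈p∩q⁺ (α∈R , α∈B)) (x∈p∩q⁺ (β∈R , β∈B)))))

    no-smaller-2connected : ¬ (Σ (Graph n) λ H → H ⊏ B × TwoConnected H × (R ∩ V B) ⊆ V H)
    no-smaller-2connected (H , H⊏B , H-2conn , R′⊆H)
      with ⊏⇒∃-missingEdge {K = B} {H = H} (λ _ → ∃-edge-at B-2conn) H⊏B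
    ... | s , t , st∈B , st∉H = undeletable st∈B λ α≢β α∈R β∈R α∈B β∈B →
      linkage {G = G} B-block st∈B (proj₁ H⊏B) st-not-in-H H-2conn
        (R′⊆H (x∈p∩q⁺ (α∈R , α∈B))) (R′⊆H (x∈p∩q⁺ (β∈R , β∈B))) α≢β
      where
        st-not-in-H : ∀ {x y} → E H x y ≡ true → ¬ SameEdge (x , y) (s , t)
        st-not-in-H xy∈H same = b≡true⇒b≢false (SameEdge-E H (SameEdge-sym same) xy∈H) st∉H
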